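{- Let $D$ be a digraph each of whose weak components has a source, and suppose that the $m$-step competition graph $C^m(D)$ is triangle-free for some integer $m \geq 2$. Then the number of sources of $D$ is at most the number of components of $C^m(D)$.
   Context: All digraphs are finite, may have loops, and (standing assumption) every vertex has outdegree at least $1$. For a positive integer $m$, a vertex $y$ is an $m$-step prey of $x$ if there is a directed walk of length $m$ from $x$ to $y$. The $m$-step competition graph $C^m(D)$ has vertex set $V(D)$ and an edge between distinct vertices $x,y$ iff they have a common $m$-step prey. A source is a vertex of indegree $0$. A weak component of $D$ is the subdigraph induced by a component of the underlying undirected graph of $D$. -}

module Defs where

open import Data.Nat using (ℕ; zero; suc)
open import Data.Fin using (Fin)
open import Data.Bool using (Bool; true; false; not)
open import Data.List using (List; length; filterᵇ; allFin)
open import Data.Bool.ListAction using (any)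
open import Data.Product using (Σ; ∃; _×_; _,_)
open import Data.Sum using (_⊎_)
open import Relation.Nullary using (¬_)
open import Relation.Binary.PropositionalEquality using (_≡_; _≢_)
open import Relation.Binary.Construct.Closure.ReflexiveTransitive using (Star)

-- A digraph on the vertex set Fin n, given by its (Boolean) arc relation.
-- Loops are allowed (A x x may be true).
Digraph : ℕ → Set
Digraph n = Fin n → Fin n → Bool

module _ {n : ℕ} (D : Digraph n) where

  Arc : Fin n → Fin n → Set
  Arc x y = D x y ≡ true

  OutdegPos : Set
  OutdegPos = ∀ x → ∃ λ y → Arc x y

  data Walk : ℕ → Fin n → Fin n → Set where
    [] : ∀ {x} → Walk zero x x
    _∷_ : ∀ {m x y z} → Arc x y → Walk m y z → Walk (suc m) x z

  Prey : ℕ → Fin n → Fin n → Set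
  Prey m x y = Walk m x y

  CEdge : ℕ → Fin n → Fin n → Set
  CEdge m x y = x ≢ y × ∃ λ z → Prey m x z × Prey m y z

  TriangleFree : ℕ → Set
  TriangleFree m = ∀ x y z → ¬ (CEdge m x y × CEdge m y z × CEdge m x z)

  CConnected : ℕ → Fin n → Fin n → Set
  CConnected m = Star (CEdge m)

  -- c labels the components of C^m(D) bijectively by Fin k,
  -- i.e. C^m(D) has exactly k components
  ComponentLabelling : ℕ → (k : ℕ) → (Fin n → Fin k) → Set
  ComponentLabelling m k c =
    (∀ x y → c x ≡ c y → CConnected m x y) ×
    (∀ x y → CConnected m x y → c x ≡ c y) ×
    (∀ i → ∃ λ x → c x ≡ i)

  Source : Fin n → Set
  Source x = ∀ y → D y x ≡ false

  isSourceᵇ : Fin n → Bool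
  isSourceᵇ x = not (any (λ y → D y x) (allFin n))

  numSources : ℕ
  numSources = length (filterᵇ isSourceᵇ (allFin n))

  UEdge : Fin n → Fin n → Set
  UEdge x y = Arc x y ⊎ Arc y x

  WeaklyConnected : Fin n → Fin n → Set
  WeaklyConnected = Star UEdge

  EveryWeakComponentHasSource : Set
  EveryWeakComponentHasSource = ∀ x → ∃ λ s → Source s × WeaklyConnected x s

-- Fix a root in every component of C^m(D) and give each other vertex x a parent y
-- one step closer to the root of its component, so that x and y have a common
-- m-step prey z. Because C^m(D) is triangle-free, at most two vertices have z as
-- m-step prey, and since parents are strictly closer to the root, distinct
-- non-roots get distinct preys. Every m-step prey has an in-neighbour, so this
-- injects the non-roots into the non-sources: n − k ≤ n − #sources.
module Submission where

open import Defs
open import Data.Nat using (ℕ; _≤_)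
open import Data.Fin using (Fin)

open import Data.Nat using (zero; suc; _+_; _<_; s≤s)
open import Data.Nat.Properties using (module ≤-Reasoning; anyUpTo?; +-suc; ≮⇒≥; <-asym; +-cancelʳ-≤)
open import Data.Nat.Induction using (<-wellFounded)
open import Induction.WellFounded using (Acc; acc)
open import Data.Fin using (join; splitAt)
open import Data.Fin.Properties using (_≟_; any?; injective⇒≤; splitAt-join)
open import Data.Bool using (Bool; true; false; not; T; T?)
open import Data.Bool.Properties using (not-involutive)
import Data.Bool.Properties as Bool
open import Data.List using (List; []; _∷_; length; filterᵇ; allFin; lookup)
open import Data.List.Properties using (length-tabulate)
open import Data.List.Relation.Unary.Any using (index)
open import Data.List.Relation.Unary.Any.Properties using (any⁺; lookup-index)
open import Data.List.Membership.Propositional using (_∈_; lose)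
open import Data.List.Membership.Propositional.Properties using (∈-allFin; ∈-filter⁺)
open import Data.Product using (∃; _×_; _,_; proj₁; proj₂)
open import Data.Sum using (_⊎_; inj₁; inj₂)
open import Data.Sum.Properties using (inj₁-injective; inj₂-injective)
open import Data.Empty using (⊥-elim)
open import Function using (_∘_)
open import Relation.Nullary using (Dec; yes; no; contradiction)
open import Relation.Nullary.Decidable using (_×-dec_; _⊎-dec_; ¬?)
open import Relation.Unary using (Pred)
import Relation.Unary as U
open import Relation.Binary using (Decidable)
open import Relation.Binary.PropositionalEquality
  using (_≡_; _≢_; refl; sym; trans; cong; subst; ≢-sym; module ≡-Reasoning)
open import Relation.Binary.Construct.Closure.ReflexiveTransitive using (Star; ε; _◅_)

module _ {p} {P : Pred ℕ p} (P? : U.Decidable P) where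

  leastWitness : ∀ {j} → P j → ∃ λ i → P i × (∀ {l} → P l → i ≤ l)
  leastWitness = go (<-wellFounded _)
    where
    go : ∀ {j} → Acc _<_ j → P j → ∃ λ i → P i × (∀ {l} → P l → i ≤ l)
    go {j} (acc smaller) pj with anyUpTo? P? j
    ... | yes (l , l<j , pl) = go (smaller l<j) pl
    ... | no none = j , pj , λ {l} pl → ≮⇒≥ λ l<j → none (l , l<j , pl)

length-filterᵇ-complement : ∀ {a} {A : Set a} (p : A → Bool) (xs : List A) →
  length (filterᵇ p xs) + length (filterᵇ (not ∘ p) xs) ≡ length xs
length-filterᵇ-complement p [] = refl
length-filterᵇ-complement p (x ∷ xs) with p x
... | true = cong suc (length-filterᵇ-complement p xs)
... | false = trans (+-suc _ _) (cong suc (length-filterᵇ-complement p xs))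

-- The components of R are the fibres of c, and depth x is the breadth-first
-- distance from x to the root of its component.
module SpanningForest
  {n k} {R : Fin n → Fin n → Set} (R? : Decidable R)
  (c : Fin n → Fin k)
  (connected : ∀ x y → c x ≡ c y → Star R x y)
  (R-resp-c : ∀ {x y} → R x y → c x ≡ c y)
  (root : Fin k → Fin n) (c-root : ∀ i → c (root i) ≡ i)
  where

  WithinSteps : Fin n → ℕ → Fin n → Set
  WithinSteps s zero x = x ≡ s
  WithinSteps s (suc j) x = x ≡ s ⊎ ∃ λ y → WithinSteps s j y × R y x

  withinSteps? : ∀ s j x → Dec (WithinSteps s j x)
  withinSteps? s zero x = x ≟ s
  withinSteps? s (suc j) x = x ≟ s ⊎-dec any? λ y → withinSteps? s j y ×-dec R? y x

  withinSteps-◅◅ : ∀ {s j y x} → WithinSteps s j y → Star R y x → ∃ λ j′ → WithinSteps s j′ x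
  withinSteps-◅◅ {j = j} within ε = j , within
  withinSteps-◅◅ {y = y} within (r ◅ path) = withinSteps-◅◅ (inj₂ (y , within , r)) path

  private
    depthWitness : ∀ x → ∃ λ i → WithinSteps (root (c x)) i x × (∀ {l} → WithinSteps (root (c x)) l x → i ≤ l)
    depthWitness x = leastWitness (λ j → withinSteps? s j x)
      (proj₂ (withinSteps-◅◅ {j = 0} refl (connected s x (c-root (c x)))))
      where s = root (c x)

  depth : Fin n → ℕ
  depth x = proj₁ (depthWitness x)

  depth-minimal : ∀ {x j} → WithinSteps (root (c x)) j x → depth x ≤ j
  depth-minimal {x} = proj₂ (proj₂ (depthWitness x))

  parent : ∀ x → x ≢ root (c x) → ∃ λ y → R y x × depth y < depth x
  parent x x≢root = stepBack (proj₁ (proj₂ (depthWitness x)))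
    where
    stepBack : ∀ {j} → WithinSteps (root (c x)) j x → ∃ λ y → R y x × depth y < j
    stepBack {zero} x≡root = contradiction x≡root x≢root
    stepBack {suc j} (inj₁ x≡root) = contradiction x≡root x≢root
    stepBack {suc j} (inj₂ (y , within , r)) =
      y , r , s≤s (depth-minimal (subst (λ s → WithinSteps s j y) (cong root (sym (R-resp-c r))) within))

module _ {n} (D : Digraph n) where

  walk? : ∀ m x z → Dec (Walk D m x z)
  walk? zero x z with x ≟ z
  ... | yes refl = yes []
  ... | no x≢z = no λ { [] → x≢z refl }
  walk? (suc m) x z with any? (λ y → (D x y Bool.≟ true) ×-dec walk? m y z)
  ... | yes (y , arc , walk) = yes (arc ∷ walk)
  ... | no noStep = no λ { (_∷_ {y = y} arc walk) → noStep (y , arc , walk) }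

  cedge? : ∀ m → Decidable (CEdge D m)
  cedge? m x y = ¬? (x ≟ y) ×-dec any? λ z → walk? m x z ×-dec walk? m y z

  walk-lastArc : ∀ {m x z} → Walk D (suc m) x z → ∃ λ w → Arc D w z
  walk-lastArc (_∷_ {x = w} arc []) = w , arc
  walk-lastArc (_ ∷ walk@(_ ∷ _)) = walk-lastArc walk

  nonSources : List (Fin n)
  nonSources = filterᵇ (not ∘ isSourceᵇ D) (allFin n)

  numSources+nonSources : numSources D + length nonSources ≡ n
  numSources+nonSources = trans (length-filterᵇ-complement (isSourceᵇ D) (allFin n)) (length-tabulate _)

  arc⇒∈nonSources : ∀ {w z} → Arc D w z → z ∈ nonSources
  arc⇒∈nonSources {w} {z} arc = ∈-filter⁺ (T? ∘ not ∘ isSourceᵇ D) (∈-allFin z)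
    (subst T (sym (not-involutive _)) (any⁺ (λ y → D y z) (lose (∈-allFin w) (subst T (sym arc) _))))

  commonPrey-atMostTwo : ∀ {m x y w z} → TriangleFree D m →
    Prey D m x z → Prey D m y z → Prey D m w z → x ≢ y → x ≢ w → y ≡ w
  commonPrey-atMostTwo {y = y} {w} triangleFree px py pw x≢y x≢w with y ≟ w
  ... | yes y≡w = y≡w
  ... | no y≢w = ⊥-elim (triangleFree _ _ _ ((x≢y , _ , px , py) , (y≢w , _ , py , pw) , (x≢w , _ , px , pw)))

  -- If x and x′ would differ, triangle-freeness forces y = x′ and y′ = x.
  commonPrey-descending⇒≡ : ∀ {m x x′ y y′ z} → TriangleFree D m → (rank : Fin n → ℕ) →
    Prey D m x z → Prey D m x′ z → Prey D m y z → Prey D m y′ z → y ≢ x → y′ ≢ x′ →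
    rank y < rank x → rank y′ < rank x′ → x ≡ x′
  commonPrey-descending⇒≡ {x = x} {x′} triangleFree rank px px′ py py′ y≢x y′≢x′ y<x y′<x′ with x ≟ x′
  ... | yes x≡x′ = x≡x′
  ... | no x≢x′ = contradiction (subst (λ a → rank a < rank x′) y′≡x y′<x′) (<-asym x′<x)
    where
    y≡x′ = commonPrey-atMostTwo triangleFree px py px′ (≢-sym y≢x) x≢x′
    y′≡x = commonPrey-atMostTwo triangleFree px′ py′ px (≢-sym y′≢x′) (≢-sym x≢x′)
    x′<x = subst (λ a → rank a < rank x) y≡x′ y<x

module NonRootsToNonSources
  {n} (D : Digraph n) (m : ℕ) (triangleFree : TriangleFree D (suc m))
  (k : ℕ) (c : Fin n → Fin k) (labelling : ComponentLabelling D (suc m) k c)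
  where

  private
    connected = proj₁ labelling
    sameComponent = proj₁ (proj₂ labelling)
    representative = proj₂ (proj₂ labelling)

  root : Fin k → Fin n
  root i = proj₁ (representative i)

  open SpanningForest (cedge? D (suc m)) c connected (λ e → sameComponent _ _ (e ◅ ε))
    root (λ i → proj₂ (representative i))

  prey : ∀ x → x ≢ root (c x) → Fin n
  prey x x≢root = let (_ , (_ , z , _) , _) = parent x x≢root in z

  prey∈nonSources : ∀ x (x≢root : x ≢ root (c x)) → prey x x≢root ∈ nonSources D
  prey∈nonSources x x≢root =
    let (_ , (_ , _ , _ , px) , _) = parent x x≢root in arc⇒∈nonSources D (proj₂ (walk-lastArc D px))

  prey-injective : ∀ {x x′} x≢root x′≢root → prey x x≢root ≡ prey x′ x′≢root → x ≡ x′
  prey-injective {x} {x′} x≢root x′≢root same =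
    let (_ , (y≢x , _ , py , px) , y<x) = parent x x≢root
        (_ , (y′≢x′ , _ , py′ , px′) , y′<x′) = parent x′ x′≢root
    in commonPrey-descending⇒≡ D triangleFree depth px (atPrey px′) py (atPrey py′) y≢x y′≢x′ y<x y′<x′
    where
    atPrey : ∀ {v} → Prey D (suc m) v (prey x′ x′≢root) → Prey D (suc m) v (prey x x≢root)
    atPrey = subst (Prey D (suc m) _) (sym same)

  code : ∀ x → Dec (x ≡ root (c x)) → Fin k ⊎ Fin (length (nonSources D))
  code x (yes _) = inj₁ (c x)
  code x (no x≢root) = inj₂ (index (prey∈nonSources x x≢root))

  code-injective : ∀ {x x′} d d′ → code x d ≡ code x′ d′ → x ≡ x′
  code-injective (yes x≡root) (yes x′≡root) same =
    trans x≡root (trans (cong root (inj₁-injective same)) (sym x′≡root))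
  code-injective (no x≢root) (no x′≢root) same = prey-injective x≢root x′≢root (begin
    prey _ x≢root                                           ≡⟨ lookup-index (prey∈nonSources _ x≢root) ⟩
    lookup (nonSources D) (index (prey∈nonSources _ x≢root))  ≡⟨ cong (lookup (nonSources D)) (inj₂-injective same) ⟩
    lookup (nonSources D) (index (prey∈nonSources _ x′≢root)) ≡⟨ lookup-index (prey∈nonSources _ x′≢root) ⟨
    prey _ x′≢root                                          ∎)
    where open ≡-Reasoning

  encode : Fin n → Fin (k + length (nonSources D))
  encode x = join k _ (code x (x ≟ root (c x)))

  encode-injective : ∀ {x x′} → encode x ≡ encode x′ → x ≡ x′
  encode-injective {x} {x′} same = code-injective _ _ (begin
    code x d                         ≡⟨ splitAt-join k _ (code x d) ⟨
    splitAt k (join k _ (code x d))    ≡⟨ cong (splitAt k) same ⟩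
    splitAt k (join k _ (code x′ d′))  ≡⟨ splitAt-join k _ (code x′ d′) ⟩
    code x′ d′                       ∎)
    where
    open ≡-Reasoning
    d = x ≟ root (c x)
    d′ = x′ ≟ root (c x′)

lemma3p5 : (n : ℕ) (D : Digraph n) → OutdegPos D →
    EveryWeakComponentHasSource D →
    (m : ℕ) → 2 ≤ m → TriangleFree D m →
    (k : ℕ) (c : Fin n → Fin k) → ComponentLabelling D m k c →
    numSources D ≤ k
lemma3p5 n D _ _ (suc m) (s≤s _) triangleFree k c labelling = +-cancelʳ-≤ (length (nonSources D)) _ _ (begin
  numSources D + length (nonSources D) ≡⟨ numSources+nonSources D ⟩
  n                                    ≤⟨ injective⇒≤ encode-injective ⟩
  k + length (nonSources D)            ∎)
  where
  open NonRootsToNonSources D m triangleFree k c labelling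
  open ≤-Reasoning
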